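{- Let $s$ be a sufficiently large integer and let $n = 1+5s$. Let $V = V_1 \cup V_2 \cup \cdots \cup V_s \cup \{x\}$ be a set of $n$ vertices, where each $V_i$ has $5$ vertices, the sets $V_i$ are pairwise disjoint, and $x$ is an additional vertex. Let $H$ be the $3$-uniform hypergraph on $V$ whose edges are all $3$-subsets of each $V_i$ ($1\le i\le s$), together with one further edge $\{x,u,v\}$ for some fixed $u,v \in V_1$. Let $\mathcal{L} = \{H(v) : v \in V\}$ be the set of all links of $H$. Then $ex(n-1,\mathcal{L}) = 0$, but $$ex(n,H) \ge \binom{n-2}{3} + \frac{4}{3}\binom{n-2}{2} = \binom{n-1}{3} + \frac{1}{3}\binom{n-2}{2} > \binom{n-1}{3} + ex(n-1,\mathcal{L}).$$
   Context: For a $k$-uniform hypergraph $H=(V,E)$ and a vertex $v$, the link of $v$ is the $(k-1)$-uniform hypergraph $H(v) = (V\setminus\{v\}, E_v)$ where $\{x_1,\dots,x_{k-1}\} \in E_v$ iff $\{v,x_1,\dots,x_{k-1}\} \in E$; here the links are graphs on $n-1$ vertices. For a $k$-uniform hypergraph $H$, $ex(n,H)$ is the maximum number of edges in a $k$-uniform hypergraph on $n$ vertices containing no sub-hypergraph isomorphic to $H$. For a family $\mathcal{L}$ of $(k-1)$-uniform hypergraphs, $ex(m,\mathcal{L})$ is the maximum number of edges in a $(k-1)$-uniform hypergraph on $m$ vertices that contains no member of $\mathcal{L}$ as a subhypergraph. -}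

module Defs where

open import Data.Nat using (ℕ; zero; suc; _+_; _*_; _≤_; _≡ᵇ_; _≤ᵇ_)
open import Data.Bool using (Bool; true; false; _∧_; _∨_; not; if_then_else_)
open import Data.Fin using (Fin; zero; suc; toℕ; punchIn; _≟_)
open import Data.Fin.Subset using (Subset; ∣_∣)
open import Data.Vec using (Vec; []; _∷_; tabulate; lookup)
open import Data.List using (List; []; _∷_; _++_; map)
open import Data.Product using (Σ; _×_; ∃-syntax)
open import Relation.Binary.PropositionalEquality using (_≡_)
open import Relation.Nullary using (¬_; ⌊_⌋)
open import Function.Definitions using (Injective)

allF : ∀ {m} → (Fin m → Bool) → Bool
allF {zero}  f = true
allF {suc m} f = f zero ∧ allF (λ i → f (suc i))

anyF : ∀ {m} → (Fin m → Bool) → Bool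
anyF {zero}  f = false
anyF {suc m} f = f zero ∨ anyF (λ i → f (suc i))

Hyp : ℕ → Set
Hyp m = Subset m → Bool

Uniform : ∀ {m} → ℕ → Hyp m → Set
Uniform {m} k G = ∀ (e : Subset m) → G e ≡ true → ∣ e ∣ ≡ k

img : ∀ {p m} → (Fin p → Fin m) → Subset p → Subset m
img f e = tabulate (λ j → anyF (λ i → lookup e i ∧ ⌊ f i ≟ j ⌋))

Contains : ∀ {m p} → Hyp m → Hyp p → Set
Contains {m} {p} G F =
  Σ (Fin p → Fin m) λ f → Injective _≡_ _≡_ f × (∀ e → F e ≡ true → G (img f e) ≡ true)

Free : ∀ {m p} {I : Set} → Hyp m → (I → Hyp p) → Set
Free G fam = ∀ i → ¬ Contains G (fam i)

allSubsets : (m : ℕ) → List (Subset m)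
allSubsets zero    = [] ∷ []
allSubsets (suc m) = map (true ∷_) (allSubsets m) ++ map (false ∷_) (allSubsets m)

countTrue : List Bool → ℕ
countTrue []            = 0
countTrue (true ∷ bs)   = suc (countTrue bs)
countTrue (false ∷ bs)  = countTrue bs

edges : ∀ {m} → Hyp m → ℕ
edges {m} G = countTrue (map G (allSubsets m))

IsEx : ∀ {p} {I : Set} → ℕ → (m : ℕ) → (I → Hyp p) → ℕ → Set
IsEx k m fam N =
  (Σ (Hyp m) λ G → Uniform k G × Free G fam × edges G ≡ N) ×
  (∀ (G : Hyp m) → Uniform k G → Free G fam → edges G ≤ N)

-- The hypergraph H of the proposition on Fin (1 + 5 s):
-- vertex 0 is x; block V_{i+1} (i : Fin s) = vertices with index 5i+1 .. 5i+5;
-- the extra edge is {x, u, v} with u,v ∈ V_1 the vertices 1+u, 1+v (u v : Fin 5).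
inBlock : ∀ {n} → ℕ → Fin n → Bool
inBlock i j = ((5 * i + 1) ≤ᵇ toℕ j) ∧ (toℕ j ≤ᵇ (5 * i + 5))

Hgraph : (s : ℕ) → Fin 5 → Fin 5 → Hyp (suc (5 * s))
Hgraph s u v e =
  ((∣ e ∣ ≡ᵇ 3) ∧ anyF {s} (λ i → allF (λ j → not (lookup e j) ∨ inBlock (toℕ i) j)))
  ∨ allF (λ j → eqSpecial j)
  where
  special : Fin (suc (5 * s)) → Bool
  special j = (toℕ j ≡ᵇ 0) ∨ (toℕ j ≡ᵇ suc (toℕ u)) ∨ (toℕ j ≡ᵇ suc (toℕ v))
  eqSpecial : Fin (suc (5 * s)) → Bool
  eqSpecial j = if lookup e j then special j else not (special j)

-- link of vertex w in a hypergraph on Fin (suc m): a hypergraph on the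
-- remaining m vertices, relabelled via punchIn w
link : ∀ {m} → Hyp (suc m) → Fin (suc m) → Hyp m
link {m} G w e = G (tabulate (λ j → ⌊ j ≟ w ⌋ ∨ lookup (img (punchIn w) e) j))

module Submission where

-- The link of x is the single edge {u,v}, so every graph with
--     an edge contains it (relabel by two transpositions); every link of H
--     has an edge, so the empty graph is link-free.  Hence the extremal
--     number of the links is 0.
-- (2) ex(n,H) is attained: containment is decidable (finitely many vertex
--     maps and subsets), and hypergraphs on Fin n form a finite list up to
--     pointwise equality, so an edge-maximal H-free 3-graph exists.
-- (3) Lower bound.  On vertices a, b and m = n-2 further vertices take all
--     triples avoiding a and b, and {a,y,z}, {b,y,z} for every edge yz of the
--     complete tripartite graph T with colour classes j mod 3.  This has
--     C(m,3) + 2e(T) edges and 3e(T) ≥ 2·C(m,2).  It is H-free: an embedding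
--     of H is a bijection, so some vertex of a block V_i goes to a or b; the
--     other four vertices of V_i then form a clique in the link of a or b,
--     which is properly 3-coloured, contradicting the pigeonhole principle.
-- (4) The displayed (in)equalities are binomial arithmetic.

open import Defs
open import Data.Nat using (ℕ; zero; suc; _+_; _*_; _∸_; _≤_; _<_; z≤n; s≤s; _≡ᵇ_; _≤ᵇ_)
import Data.Nat.Properties as NP
open import Data.Nat.Combinatorics using (_C_; nCk+nC[k+1]≡[n+1]C[k+1]; nC1≡n)
open import Data.Nat.DivMod using (_/_; _%_; m≡m%n+[m/n]*n; m%n<n; m<n*o⇒m/o<n)
open import Data.Nat.Tactic.RingSolver using (solve-∀)
open import Data.Fin using (Fin; zero; suc; toℕ; fromℕ<; punchIn; punchOut; _≟_) renaming (_<_ to _<ᶠ_)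
import Data.Fin.Properties as FP
import Data.Fin.Permutation.Components as PC
open import Data.Fin.Subset using (Subset; ∣_∣)
open import Data.Bool using (Bool; true; false; _∧_; _∨_; not; if_then_else_; T)
import Data.Bool.Properties as BP
open import Data.Vec using (Vec; []; _∷_; tabulate; lookup)
open import Data.Vec.Properties using (lookup∘tabulate; tabulate-cong; tabulate∘lookup)
open import Data.List using (List; []; _∷_; _++_; map; filter; cartesianProductWith)
import Data.List.Properties as LP
open import Data.List.Membership.Propositional using (_∈_)
open import Data.List.Membership.Propositional.Properties
  using (∈-cartesianProductWith⁺; ∈-map⁺; ∈-++⁺ˡ; ∈-++⁺ʳ; ∈-filter⁺)
open import Data.List.Relation.Unary.Any using (here; there)
import Data.List.Relation.Unary.All as All
open import Data.List.Relation.Unary.All.Properties using (all-filter)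
open import Data.List.Extrema.Nat using (argmax; argmax-all; f[xs]≤f[argmax])
open import Data.Unit using (⊤; tt)
open import Data.Empty using (⊥; ⊥-elim)
open import Data.Product using (Σ; _×_; _,_; proj₁; proj₂; ∃-syntax; ∃)
open import Function.Bundles using (Equivalence)
open import Function.Definitions using (Injective)
open import Relation.Binary.PropositionalEquality
open import Relation.Nullary using (¬_; ¬?; ⌊_⌋; Dec; yes; no; does; _because_)
open import Relation.Nullary.Decidable using (_→-dec_; _×-dec_; map′; dec-true; dec-false)

∧-elim : ∀ {a b} → a ∧ b ≡ true → a ≡ true × b ≡ true
∧-elim {true} {true} _ = refl , refl

∧-intro : ∀ {a b} → a ≡ true → b ≡ true → a ∧ b ≡ true
∧-intro refl refl = refl

∨-introˡ : ∀ {a b} → a ≡ true → a ∨ b ≡ true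
∨-introˡ refl = refl

∨-introʳ : ∀ {a b} → b ≡ true → a ∨ b ≡ true
∨-introʳ {a} eq = trans (cong (a ∨_) eq) (BP.∨-zeroʳ a)

∨-elimʳ : ∀ {a b} → a ≡ false → a ∨ b ≡ true → b ≡ true
∨-elimʳ refl eq = eq

∨-interchange : ∀ a b c d → (a ∨ b) ∨ (c ∨ d) ≡ (a ∨ c) ∨ (b ∨ d)
∨-interchange true b c d = refl
∨-interchange false true true d = refl
∨-interchange false true false d = refl
∨-interchange false false c d = refl

T⇒≡true : ∀ {b} → T b → b ≡ true
T⇒≡true = Equivalence.to BP.T-≡

≡ᵇ⇒≡ : ∀ {a b} → (a ≡ᵇ b) ≡ true → a ≡ b
≡ᵇ⇒≡ {a} {b} eq = NP.≡ᵇ⇒≡ a b (Equivalence.from BP.T-≡ eq)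

≡ᵇ-refl : ∀ a → (a ≡ᵇ a) ≡ true
≡ᵇ-refl a = T⇒≡true (NP.≡⇒≡ᵇ a a refl)

isYes≡does : ∀ {A : Set} (d : Dec A) → ⌊ d ⌋ ≡ does d
isYes≡does (true because _) = refl
isYes≡does (false because _) = refl

does-sym : ∀ {n} (a b : Fin n) → does (a ≟ b) ≡ does (b ≟ a)
does-sym a b with a ≟ b | b ≟ a
... | yes _ | yes _ = refl
... | no _ | no _ = refl
... | yes a≡b | no b≢a = ⊥-elim (b≢a (sym a≡b))
... | no a≢b | yes b≡a = ⊥-elim (a≢b (sym b≡a))

does≡toℕ≡ᵇ : ∀ {n} (j a : Fin n) → does (j ≟ a) ≡ (toℕ j ≡ᵇ toℕ a)
does≡toℕ≡ᵇ j a with j ≟ a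
... | yes refl = sym (≡ᵇ-refl (toℕ j))
... | no j≢a with toℕ j ≡ᵇ toℕ a in eq
...   | false = refl
...   | true = ⊥-elim (j≢a (FP.toℕ-injective (≡ᵇ⇒≡ eq)))

doesNot : ∀ {n} (a b : Fin n) → not (does (a ≟ b)) ≡ true → a ≢ b
doesNot a b eq with a ≟ b
doesNot a b () | yes _
... | no a≢b = a≢b

anyF-cong : ∀ {m} (h k : Fin m → Bool) → (∀ i → h i ≡ k i) → anyF h ≡ anyF k
anyF-cong {zero} h k eq = refl
anyF-cong {suc m} h k eq =
  cong₂ _∨_ (eq zero) (anyF-cong (λ i → h (suc i)) (λ i → k (suc i)) (λ i → eq (suc i)))

anyF-false : ∀ {m} (h : Fin m → Bool) → (∀ i → h i ≡ false) → anyF h ≡ false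
anyF-false {zero} h eq = refl
anyF-false {suc m} h eq rewrite eq zero = anyF-false (λ i → h (suc i)) (λ i → eq (suc i))

anyF-intro : ∀ {m} (h : Fin m → Bool) i → h i ≡ true → anyF h ≡ true
anyF-intro h zero eq = ∨-introˡ eq
anyF-intro h (suc i) eq = ∨-introʳ (anyF-intro (λ i → h (suc i)) i eq)

allF-intro : ∀ {m} (h : Fin m → Bool) → (∀ i → h i ≡ true) → allF h ≡ true
allF-intro {zero} h eq = refl
allF-intro {suc m} h eq = ∧-intro (eq zero) (allF-intro (λ i → h (suc i)) (λ i → eq (suc i)))

allF-elim : ∀ {m} (h : Fin m → Bool) → allF h ≡ true → ∀ i → h i ≡ true
allF-elim h eq zero = proj₁ (∧-elim eq)
allF-elim h eq (suc i) = allF-elim (λ i → h (suc i)) (proj₂ (∧-elim eq)) i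

anyF-∨ : ∀ {m} (A B C : Fin m → Bool) →
  anyF (λ i → (A i ∨ B i) ∧ C i) ≡ anyF (λ i → A i ∧ C i) ∨ anyF (λ i → B i ∧ C i)
anyF-∨ {zero} A B C = refl
anyF-∨ {suc m} A B C =
  trans (cong₂ _∨_ (BP.∧-distribʳ-∨ (C zero) (A zero) (B zero))
                   (anyF-∨ (λ i → A (suc i)) (λ i → B (suc i)) (λ i → C (suc i))))
        (∨-interchange (A zero ∧ C zero) (B zero ∧ C zero)
                       (anyF (λ i → A (suc i) ∧ C (suc i))) (anyF (λ i → B (suc i) ∧ C (suc i))))

anyF-point : ∀ {m} (a : Fin m) (h : Fin m → Bool) → anyF (λ i → does (i ≟ a) ∧ h i) ≡ h a
anyF-point {suc m} zero h =
  trans (cong (h zero ∨_) (anyF-false {m} _ (λ i → refl))) (BP.∨-identityʳ (h zero))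
anyF-point {suc m} (suc a) h = anyF-point a (λ i → h (suc i))

vec-ext : ∀ {n} {A : Set} (v w : Vec A n) → (∀ j → lookup v j ≡ lookup w j) → v ≡ w
vec-ext v w eq = trans (sym (tabulate∘lookup v)) (trans (tabulate-cong eq) (tabulate∘lookup w))

-- Counting edges.  allSubsets (suc m) lists the subsets containing 0 first,
-- so the edge count splits according to whether the first vertex is used.
countTrue-++ : ∀ xs ys → countTrue (xs ++ ys) ≡ countTrue xs + countTrue ys
countTrue-++ [] ys = refl
countTrue-++ (true ∷ xs) ys = cong suc (countTrue-++ xs ys)
countTrue-++ (false ∷ xs) ys = countTrue-++ xs ys

edges-split : ∀ {m} (G : Hyp (suc m)) →
  edges G ≡ edges {m} (λ r → G (true ∷ r)) + edges {m} (λ r → G (false ∷ r))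
edges-split {m} G = begin
  countTrue (map G (ins ++ outs))
    ≡⟨ cong countTrue (LP.map-++ G ins outs) ⟩
  countTrue (map G ins ++ map G outs)
    ≡⟨ countTrue-++ (map G ins) (map G outs) ⟩
  countTrue (map G ins) + countTrue (map G outs)
    ≡⟨ cong₂ _+_ (cong countTrue (sym (LP.map-∘ (allSubsets m))))
                 (cong countTrue (sym (LP.map-∘ (allSubsets m)))) ⟩
  edges {m} (λ r → G (true ∷ r)) + edges {m} (λ r → G (false ∷ r)) ∎
  where
  open ≡-Reasoning
  ins outs : List (Subset (suc m))
  ins = map (true ∷_) (allSubsets m)
  outs = map (false ∷_) (allSubsets m)

edges-cong : ∀ {m} (G G' : Hyp m) → (∀ e → G e ≡ G' e) → edges G ≡ edges G'
edges-cong {m} G G' eq = cong countTrue (LP.map-cong eq (allSubsets m))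

edges-empty : ∀ m → edges {m} (λ _ → false) ≡ 0
edges-empty zero = refl
edges-empty (suc m) =
  trans (edges-split {m} (λ _ → false)) (cong₂ _+_ (edges-empty m) (edges-empty m))

edge-of-positive : ∀ {m} (G : Hyp m) (k : ℕ) → edges G ≡ suc k → ∃ λ e → G e ≡ true
edge-of-positive {zero} G k eq with G [] in g
... | true = [] , g
... | false = ⊥-elim (NP.0≢1+n eq)
edge-of-positive {suc m} G k eq with edges {m} (λ r → G (true ∷ r)) in e₁
... | suc k₁ = let (e , p) = edge-of-positive {m} (λ r → G (true ∷ r)) k₁ e₁ in (true ∷ e) , p
... | zero with edges {m} (λ r → G (false ∷ r)) in e₂
...   | suc k₂ = let (e , p) = edge-of-positive {m} (λ r → G (false ∷ r)) k₂ e₂ in (false ∷ e) , p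
...   | zero = ⊥-elim (NP.0≢1+n (trans (sym (trans (edges-split G) (cong₂ _+_ e₁ e₂))) eq))

edges-complete : ∀ m k → edges {m} (λ r → ∣ r ∣ ≡ᵇ k) ≡ m C k
edges-complete zero zero = refl
edges-complete zero (suc k) = refl
edges-complete (suc m) zero =
  trans (edges-split {m} (λ r → ∣ r ∣ ≡ᵇ 0)) (cong₂ _+_ (edges-empty m) (edges-complete m zero))
edges-complete (suc m) (suc k) =
  trans (edges-split {m} (λ r → ∣ r ∣ ≡ᵇ suc k))
        (trans (cong₂ _+_ (edges-complete m k) (edges-complete m (suc k)))
               (nCk+nC[k+1]≡[n+1]C[k+1] m k))

mem : ∀ {n} → List (Fin n) → Fin n → Bool
mem [] j = false
mem (a ∷ l) j = does (j ≟ a) ∨ mem l j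

⟦_⟧ : ∀ {n} → List (Fin n) → Subset n
⟦ l ⟧ = tabulate (mem l)

mem⇒∈ : ∀ {n} (l : List (Fin n)) j → mem l j ≡ true → j ∈ l
mem⇒∈ (a ∷ l) j eq with j ≟ a
... | yes j≡a = here j≡a
... | no _ = there (mem⇒∈ l j eq)

img-⟦⟧ : ∀ {p m} (f : Fin p → Fin m) (l : List (Fin p)) → img f ⟦ l ⟧ ≡ ⟦ map f l ⟧
img-⟦⟧ {p} f l = tabulate-cong λ j →
  trans (anyF-cong _ _ λ i → cong₂ _∧_ (lookup∘tabulate (mem l) i) (isYes≡does (f i ≟ j)))
        (go l j)
  where
  go : ∀ l j → anyF (λ i → mem l i ∧ does (f i ≟ j)) ≡ mem (map f l) j
  go [] j = anyF-false {p} _ (λ i → refl)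
  go (a ∷ l) j = trans (anyF-∨ (λ i → does (i ≟ a)) (mem l) (λ i → does (f i ≟ j)))
    (cong₂ _∨_ (trans (anyF-point a (λ i → does (f i ≟ j))) (does-sym (f a) j)) (go l j))

size-insert : ∀ {n} (a : Fin n) (Q : Fin n → Bool) → Q a ≡ false →
  ∣ tabulate (λ j → does (j ≟ a) ∨ Q j) ∣ ≡ suc ∣ tabulate Q ∣
size-insert {suc n} zero Q qa = cong suc (dropFalse (Q zero) qa)
  where
  dropFalse : ∀ b → b ≡ false → ∣ tabulate (λ j → Q (suc j)) ∣ ≡ ∣ b ∷ tabulate (λ j → Q (suc j)) ∣
  dropFalse false refl = refl
size-insert {suc n} (suc a) Q qa =
  consSuc {tabulate (λ j → does (j ≟ a) ∨ Q (suc j))} {tabulate (λ j → Q (suc j))} (Q zero)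
    (size-insert a (λ j → Q (suc j)) qa)
  where
  consSuc : ∀ {v w : Subset n} b → ∣ v ∣ ≡ suc ∣ w ∣ → ∣ b ∷ v ∣ ≡ suc ∣ b ∷ w ∣
  consSuc true eq = cong suc eq
  consSuc false eq = eq

size-empty : ∀ {n} → ∣ tabulate {n} (λ _ → false) ∣ ≡ 0
size-empty {zero} = refl
size-empty {suc n} = size-empty {n}

size-triple : ∀ {n} (a b c : Fin n) → a ≢ b → a ≢ c → b ≢ c → ∣ ⟦ a ∷ b ∷ c ∷ [] ⟧ ∣ ≡ 3
size-triple {n} a b c a≢b a≢c b≢c =
  trans (size-insert a (mem (b ∷ c ∷ []))
          (cong₂ _∨_ (dec-false (a ≟ b) a≢b) (cong (_∨ false) (dec-false (a ≟ c) a≢c))))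
   (cong suc (trans (size-insert b (mem (c ∷ [])) (cong (_∨ false) (dec-false (b ≟ c) b≢c)))
     (cong suc (trans (size-insert c (λ _ → false) refl) (cong suc (size-empty {n}))))))

size0⇒empty : ∀ {n} (e : Subset n) → ∣ e ∣ ≡ 0 → e ≡ ⟦ [] ⟧
size0⇒empty [] eq = refl
size0⇒empty (false ∷ r) eq = cong (false ∷_) (size0⇒empty r eq)

size1⇒single : ∀ {n} (e : Subset n) → ∣ e ∣ ≡ 1 → ∃ λ p → e ≡ ⟦ p ∷ [] ⟧
size1⇒single (true ∷ r) eq = zero , cong (true ∷_) (size0⇒empty r (NP.suc-injective eq))
size1⇒single (false ∷ r) eq = let (p , e≡) = size1⇒single r eq in suc p , cong (false ∷_) e≡

size2⇒pair : ∀ {n} (e : Subset n) → ∣ e ∣ ≡ 2 → ∃ λ p → ∃ λ q → p ≢ q × e ≡ ⟦ p ∷ q ∷ [] ⟧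
size2⇒pair (true ∷ r) eq =
  let (q , e≡) = size1⇒single r (NP.suc-injective eq) in zero , suc q , (λ ()) , cong (true ∷_) e≡
size2⇒pair (false ∷ r) eq =
  let (p , q , p≢q , e≡) = size2⇒pair r eq
  in suc p , suc q , (λ sp≡sq → p≢q (FP.suc-injective sp≡sq)) , cong (false ∷_) e≡

∈-allSubsets : ∀ {m} (e : Subset m) → e ∈ allSubsets m
∈-allSubsets [] = here refl
∈-allSubsets (true ∷ e) = ∈-++⁺ˡ (∈-map⁺ (true ∷_) (∈-allSubsets e))
∈-allSubsets {suc m} (false ∷ e) =
  ∈-++⁺ʳ (map (true ∷_) (allSubsets m)) (∈-map⁺ (false ∷_) (∈-allSubsets e))

∀-subset? : ∀ {m} {P : Subset m → Set} → (∀ e → Dec (P e)) → Dec (∀ e → P e)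
∀-subset? {m} P? = map′ (λ all e → All.lookup all (∈-allSubsets e))
                        (λ all → All.tabulate (λ {e} _ → all e))
                        (All.all? P? (allSubsets m))

-- Existence of a map Fin p → Fin m with a decidable property is decidable,
-- provided the property respects pointwise equality: choose the image of 0
-- and recurse on the remaining p arguments.
extend : ∀ {p m} → Fin m → (Fin p → Fin m) → Fin (suc p) → Fin m
extend a g zero = a
extend a g (suc i) = g i

∃-map? : ∀ p m (P : (Fin p → Fin m) → Set) →
  (∀ f g → (∀ i → f i ≡ g i) → P f → P g) → (∀ f → Dec (P f)) → Dec (Σ _ P)
∃-map? zero m P transfer P? with P? (λ ())
... | yes Pf = yes (_ , Pf)
... | no ¬Pf = no λ { (f , Pf) → ¬Pf (transfer f (λ ()) (λ ()) Pf) }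
∃-map? (suc p) m P transfer P?
  with FP.any? (λ a → ∃-map? p m (λ g → P (extend a g))
         (λ f g f≗g → transfer (extend a f) (extend a g) (λ { zero → refl ; (suc i) → f≗g i }))
         (λ g → P? (extend a g)))
... | yes (a , g , Pf) = yes (extend a g , Pf)
... | no ¬Pf = no λ { (f , Pf) → ¬Pf (f zero , (λ i → f (suc i)) ,
        transfer f _ (λ { zero → refl ; (suc i) → refl }) Pf) }

IsHom : ∀ {m p} → Hyp m → Hyp p → (Fin p → Fin m) → Set
IsHom G F f = ∀ e → F e ≡ true → G (img f e) ≡ true

img-cong : ∀ {p m} (f g : Fin p → Fin m) → (∀ i → f i ≡ g i) → ∀ e → img f e ≡ img g e
img-cong f g f≗g e =
  tabulate-cong (λ j → anyF-cong _ _ (λ i → cong (λ x → lookup e i ∧ ⌊ x ≟ j ⌋) (f≗g i)))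

Contains? : ∀ {m p} (G : Hyp m) (F : Hyp p) → Dec (Contains G F)
Contains? {m} {p} G F = ∃-map? p m (λ f → Injective _≡_ _≡_ f × IsHom G F f) transfer
   (λ f → injective? f ×-dec ∀-subset? (λ e → (F e BP.≟ true) →-dec (G (img f e) BP.≟ true)))
  where
  transfer : ∀ f g → (∀ i → f i ≡ g i) →
    Injective _≡_ _≡_ f × IsHom G F f → Injective _≡_ _≡_ g × IsHom G F g
  transfer f g f≗g (inj , hom) =
    (λ {x} {y} gx≡gy → inj (trans (f≗g x) (trans gx≡gy (sym (f≗g y))))) ,
    (λ e Fe → trans (cong G (img-cong g f (λ i → sym (f≗g i)) e)) (hom e Fe))
  injective? : (f : Fin p → Fin m) → Dec (Injective _≡_ _≡_ f)
  injective? f = map′ (λ h {x} {y} → h x y) (λ inj x y → inj)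
    (FP.all? (λ x → FP.all? (λ y → (f x ≟ f y) →-dec (x ≟ y))))

Contains-resp : ∀ {m p} (G G' : Hyp m) (F : Hyp p) → (∀ e → G e ≡ G' e) →
  Contains G F → Contains G' F
Contains-resp G G' F G≗G' (f , inj , hom) = f , inj , λ e Fe → trans (sym (G≗G' _)) (hom e Fe)

-- Up to pointwise equality, the hypergraphs on Fin m form a finite list.
glue : ∀ {k} → (Subset k → Bool) → (Subset k → Bool) → Subset (suc k) → Bool
glue G₁ G₂ (true ∷ r) = G₁ r
glue G₁ G₂ (false ∷ r) = G₂ r

allHyps : (m : ℕ) → List (Hyp m)
allHyps zero = (λ _ → true) ∷ (λ _ → false) ∷ []
allHyps (suc m) = cartesianProductWith glue (allHyps m) (allHyps m)

allHyps-complete : ∀ m (G : Hyp m) → ∃ λ G' → G' ∈ allHyps m × (∀ e → G e ≡ G' e)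
allHyps-complete zero G with G [] in eq
... | true = _ , here refl , λ { [] → eq }
... | false = _ , there (here refl) , λ { [] → eq }
allHyps-complete (suc m) G =
  let (G₁ , G₁∈ , G≗G₁) = allHyps-complete m (λ r → G (true ∷ r))
      (G₂ , G₂∈ , G≗G₂) = allHyps-complete m (λ r → G (false ∷ r))
  in glue G₁ G₂ , ∈-cartesianProductWith⁺ glue G₁∈ G₂∈ ,
     λ { (true ∷ r) → G≗G₁ r ; (false ∷ r) → G≗G₂ r }

MaxEdges : ∀ {m} → (Hyp m → Set) → ℕ → Set
MaxEdges {m} Good N = (Σ (Hyp m) λ G → Good G × edges G ≡ N) × (∀ G → Good G → edges G ≤ N)

edge-maximal : ∀ m (Good : Hyp m → Set) → (∀ G → Dec (Good G)) →
  (∀ G G' → (∀ e → G e ≡ G' e) → Good G → Good G') → (G₀ : Hyp m) → Good G₀ →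
  ∃ (MaxEdges Good)
edge-maximal m Good good? transfer G₀ good₀ =
  edges best , (best , argmax-all edges {P = Good} good₀ (all-filter good? (allHyps m)) , refl) ,
  maximal
  where
  candidates : List (Hyp m)
  candidates = filter good? (allHyps m)
  best : Hyp m
  best = argmax edges G₀ candidates
  maximal : ∀ G → Good G → edges G ≤ edges best
  maximal G good with allHyps-complete m G
  ... | G' , G'∈ , G≗G' =
    subst (_≤ edges best) (sym (edges-cong G G' G≗G'))
      (All.lookup (f[xs]≤f[argmax] G₀ candidates) (∈-filter⁺ good? G'∈ (transfer G G' G≗G' good)))

-- Hence ex(m, F) exists for every k and every F with an edge (for such F
-- the empty hypergraph is F-free).
ex-exists : ∀ k m {p} (F : Hyp p) → (∃ λ e → F e ≡ true) →
  ∃ λ N → IsEx k m (λ (_ : ⊤) → F) N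
ex-exists k m F (e , Fe) =
  fromMaximal (edge-maximal m Good good? transfer (λ _ → false) emptyGood)
  where
  Good : Hyp m → Set
  Good G = Uniform k G × Free G (λ (_ : ⊤) → F)
  good? : ∀ G → Dec (Good G)
  good? G = ∀-subset? (λ e → (G e BP.≟ true) →-dec (∣ e ∣ NP.≟ k)) ×-dec free?
    where
    free? : Dec (Free G (λ (_ : ⊤) → F))
    free? = map′ (λ ¬c _ → ¬c) (λ free → free tt) (¬? (Contains? G F))
  transfer : ∀ G G' → (∀ e → G e ≡ G' e) → Good G → Good G'
  transfer G G' G≗G' (uni , free) = (λ e G'e → uni e (trans (G≗G' e) G'e)) ,
    (λ i c → free i (Contains-resp G' G F (λ e → sym (G≗G' e)) c))
  emptyGood : Good (λ _ → false)
  emptyGood = (λ e ()) , λ _ (f , _ , hom) → noEdge (hom e Fe)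
    where
    noEdge : false ≢ true
    noEdge ()
  fromMaximal : ∃ (MaxEdges Good) → ∃ λ N → IsEx k m (λ (_ : ⊤) → F) N
  fromMaximal (N , (G , (uni , free) , edgesG) , maximal) =
    N , (G , uni , free , edgesG) , λ G' uni' free' → maximal G' (uni' , free')

blockVertex< : ∀ {s} (i : Fin s) (r : Fin 5) → 5 * toℕ i + 1 + toℕ r < suc (5 * s)
blockVertex< {s} i r =
  s≤s (NP.≤-trans (NP.+-monoʳ-≤ (5 * toℕ i + 1) (NP.≤-pred (FP.toℕ<n r)))
        (NP.≤-trans (NP.≤-reflexive (lastInBlock (toℕ i))) (NP.*-monoʳ-≤ 5 (FP.toℕ<n i))))
  where
  lastInBlock : ∀ x → 5 * x + 1 + 4 ≡ 5 * suc x
  lastInBlock = solve-∀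

vtx : ∀ {s} → Fin s → Fin 5 → Fin (suc (5 * s))
vtx i r = fromℕ< (blockVertex< i r)

toℕ-vtx : ∀ {s} (i : Fin s) r → toℕ (vtx i r) ≡ 5 * toℕ i + 1 + toℕ r
toℕ-vtx i r = FP.toℕ-fromℕ< (blockVertex< i r)

vtx-injective : ∀ {s} (i : Fin s) r r' → vtx i r ≡ vtx i r' → r ≡ r'
vtx-injective i r r' eq = FP.toℕ-injective (NP.+-cancelˡ-≡ (5 * toℕ i + 1) _ _
   (trans (sym (toℕ-vtx i r)) (trans (cong toℕ eq) (toℕ-vtx i r'))))

inBlock-vtx : ∀ {s} (i : Fin s) r → inBlock (toℕ i) (vtx i r) ≡ true
inBlock-vtx i r rewrite toℕ-vtx i r =
  ∧-intro (T⇒≡true (NP.≤⇒≤ᵇ (NP.m≤m+n (5 * toℕ i + 1) (toℕ r))))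
          (T⇒≡true (NP.≤⇒≤ᵇ (NP.≤-trans (NP.+-monoʳ-≤ (5 * toℕ i + 1) (NP.≤-pred (FP.toℕ<n r)))
                                        (NP.≤-reflexive (lastInBlock (toℕ i))))))
  where
  lastInBlock : ∀ x → 5 * x + 1 + 4 ≡ 5 * x + 5
  lastInBlock = solve-∀

inBlock-x : ∀ {n} k → inBlock {suc n} k zero ≡ false
inBlock-x k with (5 * k + 1) ≤ᵇ 0 in eq
... | false = refl
... | true = ⊥-elim (NP.0≢1+n (sym (trans (NP.+-comm 1 (5 * k))
               (NP.n≤0⇒n≡0 (NP.≤ᵇ⇒≤ (5 * k + 1) 0 (Equivalence.from BP.T-≡ eq))))))

block-decomposition : ∀ {s} (w : Fin (suc (5 * s))) → w ≢ zero → ∃ λ i → ∃ λ r → w ≡ vtx {s} i r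
block-decomposition zero w≢x = ⊥-elim (w≢x refl)
block-decomposition {s} (suc w) _ = i , r , FP.toℕ-injective eq
  where
  i : Fin s
  i = fromℕ< (m<n*o⇒m/o<n {toℕ w} {s} {5} (subst (toℕ w <_) (NP.*-comm 5 s) (FP.toℕ<n w)))
  r : Fin 5
  r = fromℕ< (m%n<n (toℕ w) 5)
  toℕ-i : toℕ i ≡ toℕ w / 5
  toℕ-i = FP.toℕ-fromℕ< _
  toℕ-r : toℕ r ≡ toℕ w % 5
  toℕ-r = FP.toℕ-fromℕ< _
  rearrange : ∀ a b → suc (a + b * 5) ≡ 5 * b + 1 + a
  rearrange = solve-∀
  eq : suc (toℕ w) ≡ toℕ (vtx i r)
  eq = begin
    suc (toℕ w)                           ≡⟨ cong suc (m≡m%n+[m/n]*n (toℕ w) 5) ⟩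
    suc (toℕ w % 5 + toℕ w / 5 * 5)       ≡⟨ rearrange (toℕ w % 5) (toℕ w / 5) ⟩
    5 * (toℕ w / 5) + 1 + toℕ w % 5       ≡⟨ sym (cong₂ (λ a b → 5 * a + 1 + b) toℕ-i toℕ-r) ⟩
    5 * toℕ i + 1 + toℕ r                 ≡⟨ sym (toℕ-vtx i r) ⟩
    toℕ (vtx i r)                         ∎
    where open ≡-Reasoning

block-edge : ∀ s u v (i : Fin s) r₁ r₂ r₃ → r₁ ≢ r₂ → r₁ ≢ r₃ → r₂ ≢ r₃ →
  Hgraph s u v ⟦ vtx i r₁ ∷ vtx i r₂ ∷ vtx i r₃ ∷ [] ⟧ ≡ true
block-edge s u v i r₁ r₂ r₃ r₁≢r₂ r₁≢r₃ r₂≢r₃ =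
  ∨-introˡ (∧-intro (cong (_≡ᵇ 3) (size-triple _ _ _ (distinct r₁≢r₂) (distinct r₁≢r₃) (distinct r₂≢r₃)))
    (anyF-intro _ i (allF-intro _ (withinBlock (vtx i r₁ ∷ vtx i r₂ ∷ vtx i r₃ ∷ []) inBlock-listed))))
  where
  distinct : ∀ {r r'} → r ≢ r' → vtx i r ≢ vtx i r'
  distinct r≢r' eq = r≢r' (vtx-injective i _ _ eq)
  inBlock-listed : ∀ a → a ∈ (vtx i r₁ ∷ vtx i r₂ ∷ vtx i r₃ ∷ []) → inBlock (toℕ i) a ≡ true
  inBlock-listed a (here refl) = inBlock-vtx i r₁
  inBlock-listed a (there (here refl)) = inBlock-vtx i r₂
  inBlock-listed a (there (there (here refl))) = inBlock-vtx i r₃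
  withinBlock : ∀ l → (∀ a → a ∈ l → inBlock (toℕ i) a ≡ true) →
    ∀ j → not (lookup ⟦ l ⟧ j) ∨ inBlock (toℕ i) j ≡ true
  withinBlock l inside j rewrite lookup∘tabulate (mem l) j with mem l j in eq
  ... | true = inside j (mem⇒∈ l j eq)
  ... | false = refl

link-⟦⟧ : ∀ {m} (G : Hyp (suc m)) w (l : List (Fin m)) →
  link G w ⟦ l ⟧ ≡ G ⟦ w ∷ map (punchIn w) l ⟧
link-⟦⟧ G w l = cong G (vec-ext _ _ λ j → begin
  lookup (tabulate (λ j → ⌊ j ≟ w ⌋ ∨ lookup (img (punchIn w) ⟦ l ⟧) j)) j
    ≡⟨ lookup∘tabulate (λ j → ⌊ j ≟ w ⌋ ∨ lookup (img (punchIn w) ⟦ l ⟧) j) j ⟩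
  ⌊ j ≟ w ⌋ ∨ lookup (img (punchIn w) ⟦ l ⟧) j
    ≡⟨ cong₂ _∨_ (isYes≡does (j ≟ w)) (cong (λ e → lookup e j) (img-⟦⟧ (punchIn w) l)) ⟩
  does (j ≟ w) ∨ lookup ⟦ map (punchIn w) l ⟧ j
    ≡⟨ cong (does (j ≟ w) ∨_) (lookup∘tabulate (mem (map (punchIn w) l)) j) ⟩
  mem (w ∷ map (punchIn w) l) j
    ≡⟨ sym (lookup∘tabulate (mem (w ∷ map (punchIn w) l)) j) ⟩
  lookup ⟦ w ∷ map (punchIn w) l ⟧ j ∎)
  where open ≡-Reasoning

special : ∀ {s} → Fin 5 → Fin 5 → Fin (suc (5 * s)) → Bool
special u v j = (toℕ j ≡ᵇ 0) ∨ (toℕ j ≡ᵇ suc (toℕ u)) ∨ (toℕ j ≡ᵇ suc (toℕ v))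

-- Hgraph tests "e is the special edge" vertexwise as (if e j then c else not c).
if-agree : ∀ b c → b ≡ c → (if b then c else not c) ≡ true
if-agree true .true refl = refl
if-agree false .false refl = refl

if-agree⁻ : ∀ b c → (if b then c else not c) ≡ true → b ≡ c
if-agree⁻ true true _ = refl
if-agree⁻ false false _ = refl

-- A vertex of V₁ as a vertex of the link of x (whose vertex j is j + 1).
inV₁ : ∀ t → Fin 5 → Fin (5 * suc t)
inV₁ t u = fromℕ< (NP.<-≤-trans (FP.toℕ<n u) (NP.m≤m*n 5 (suc t)))

toℕ-inV₁ : ∀ t u → toℕ (inV₁ t u) ≡ toℕ u
toℕ-inV₁ t u = FP.toℕ-fromℕ< _

special-edge : ∀ t u v → Hgraph (suc t) u v ⟦ zero ∷ suc (inV₁ t u) ∷ suc (inV₁ t v) ∷ [] ⟧ ≡ true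
special-edge t u v = ∨-introʳ (allF-intro _ (λ j → if-agree _ (special {suc t} u v j) (agree j)))
  where
  agree : ∀ j → lookup ⟦ zero ∷ suc (inV₁ t u) ∷ suc (inV₁ t v) ∷ [] ⟧ j ≡ special {suc t} u v j
  agree j rewrite lookup∘tabulate (mem (zero ∷ suc (inV₁ t u) ∷ suc (inV₁ t v) ∷ [])) j
          | does≡toℕ≡ᵇ j zero | does≡toℕ≡ᵇ j (suc (inV₁ t u)) | does≡toℕ≡ᵇ j (suc (inV₁ t v))
          | toℕ-inV₁ t u | toℕ-inV₁ t v =
    cong (λ c → (toℕ j ≡ᵇ 0) ∨ (toℕ j ≡ᵇ suc (toℕ u)) ∨ c) (BP.∨-identityʳ _)

x∉block-edges : ∀ {s} (E : Subset (suc (5 * s))) → lookup E zero ≡ true →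
  ((∣ E ∣ ≡ᵇ 3) ∧ anyF {s} (λ i → allF (λ j → not (lookup E j) ∨ inBlock (toℕ i) j))) ≡ false
x∉block-edges {s} E x∈E =
  trans (cong ((∣ E ∣ ≡ᵇ 3) ∧_) (anyF-false _ notInBlock)) (BP.∧-zeroʳ _)
  where
  notInBlock : ∀ (i : Fin s) →
    ((not (lookup E zero) ∨ inBlock {suc (5 * s)} (toℕ i) zero) ∧
      allF (λ j → not (lookup E (suc j)) ∨ inBlock (toℕ i) (suc j))) ≡ false
  notInBlock i rewrite x∈E | inBlock-x {5 * s} (toℕ i) = refl

link-x : ∀ t u v (e : Subset (5 * suc t)) → link (Hgraph (suc t) u v) zero e ≡ true →
  e ≡ ⟦ inV₁ t u ∷ inV₁ t v ∷ [] ⟧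
link-x t u v e xe∈H = vec-ext _ _ λ j →
  trans (sym (E-shift j)) (trans (E-special (suc j)) (special-shift j))
  where
  E : Subset (suc (5 * suc t))
  E = tabulate (λ j → ⌊ j ≟ zero ⌋ ∨ lookup (img suc e) j)
  E-special : ∀ j → lookup E j ≡ special {suc t} u v j
  E-special j = if-agree⁻ _ _ (allF-elim agreesWithSpecial
    (∨-elimʳ (x∉block-edges {suc t} E refl) xe∈H) j)
    where
    agreesWithSpecial : Fin (suc (5 * suc t)) → Bool
    agreesWithSpecial j = if lookup E j then special {suc t} u v j else not (special {suc t} u v j)
  E-shift : ∀ j → lookup E (suc j) ≡ lookup e j
  E-shift j = begin
    lookup E (suc j)
      ≡⟨ lookup∘tabulate (λ j → ⌊ j ≟ zero ⌋ ∨ lookup (img suc e) j) (suc j) ⟩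
    lookup (img suc e) (suc j)
      ≡⟨ lookup∘tabulate (λ j → anyF (λ i → lookup e i ∧ ⌊ suc i ≟ j ⌋)) (suc j) ⟩
    anyF (λ i → lookup e i ∧ ⌊ suc i ≟ suc j ⌋)
      ≡⟨ anyF-cong _ _ (λ i → trans (cong (lookup e i ∧_) (isYes≡does (suc i ≟ suc j)))
                                     (BP.∧-comm (lookup e i) (does (i ≟ j)))) ⟩
    anyF (λ i → does (i ≟ j) ∧ lookup e i)            ≡⟨ anyF-point j (lookup e) ⟩
    lookup e j                                        ∎
    where open ≡-Reasoning
  special-shift : ∀ j → special {suc t} u v (suc j) ≡ lookup ⟦ inV₁ t u ∷ inV₁ t v ∷ [] ⟧ j
  special-shift j rewrite lookup∘tabulate (mem (inV₁ t u ∷ inV₁ t v ∷ [])) j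
          | does≡toℕ≡ᵇ j (inV₁ t u) | does≡toℕ≡ᵇ j (inV₁ t v) | toℕ-inV₁ t u | toℕ-inV₁ t v =
    cong ((toℕ j ≡ᵇ toℕ u) ∨_) (sym (BP.∨-identityʳ _))

block-link-edge : ∀ t u v (w : Fin (suc (5 * suc t))) (i : Fin (suc t)) (r : Fin 5) → w ≡ vtx i r →
  ∃ λ e → link (Hgraph (suc t) u v) w e ≡ true
block-link-edge t u v w i r w≡ = ⟦ y' ∷ z' ∷ [] ⟧ ,
  trans (link-⟦⟧ (Hgraph (suc t) u v) w (y' ∷ z' ∷ []))
   (trans (cong (λ l → Hgraph (suc t) u v ⟦ l ⟧) relabel)
      (block-edge (suc t) u v i r (punchIn r zero) (punchIn r (suc zero))
        (r≢punchIn zero) (r≢punchIn (suc zero))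
        (λ eq → zero≢one (FP.punchIn-injective r zero (suc zero) eq))))
  where
  zero≢one : Fin.zero {3} ≢ suc zero
  zero≢one ()
  r≢punchIn : ∀ k → r ≢ punchIn r k
  r≢punchIn k eq = FP.punchInᵢ≢i r k (sym eq)
  w≢block : ∀ k → w ≢ vtx i (punchIn r k)
  w≢block k eq = r≢punchIn k (vtx-injective i _ _ (trans (sym w≡) eq))
  y' z' : Fin (5 * suc t)
  y' = punchOut (w≢block zero)
  z' = punchOut (w≢block (suc zero))
  relabel : (w ∷ punchIn w y' ∷ punchIn w z' ∷ [])
          ≡ (vtx i r ∷ vtx i (punchIn r zero) ∷ vtx i (punchIn r (suc zero)) ∷ [])
  relabel = cong₂ _∷_ w≡ (cong₂ _∷_ (FP.punchIn-punchOut (w≢block zero))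
                            (cong₂ _∷_ (FP.punchIn-punchOut (w≢block (suc zero))) refl))

-- Every link of H has an edge: {u, v} for x, a block edge for the others.
link-nonempty : ∀ t u v (w : Fin (suc (5 * suc t))) → ∃ λ e → link (Hgraph (suc t) u v) w e ≡ true
link-nonempty t u v zero = ⟦ inV₁ t u ∷ inV₁ t v ∷ [] ⟧ ,
  trans (link-⟦⟧ (Hgraph (suc t) u v) zero (inV₁ t u ∷ inV₁ t v ∷ [])) (special-edge t u v)
link-nonempty t u v (suc w) =
  let (i , r , w≡) = block-decomposition {suc t} (suc w) (λ ()) in block-link-edge t u v (suc w) i r w≡

-- Two distinct vertices can be moved to any two distinct vertices by an
-- injective map (a product of two transpositions).
move-pair : ∀ {N} (a b p q : Fin N) → a ≢ b → p ≢ q →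
  ∃ λ (f : Fin N → Fin N) → Injective _≡_ _≡_ f × f a ≡ p × f b ≡ q
move-pair a b p q a≢b p≢q = f , f-injective , fa≡p , fb≡q
  where
  sends : ∀ {N} (c d : Fin N) → PC.transpose c d c ≡ d
  sends c d rewrite dec-true (c ≟ c) refl = refl
  fixes : ∀ {N} (c d y : Fin N) → y ≢ c → y ≢ d → PC.transpose c d y ≡ y
  fixes c d y y≢c y≢d rewrite dec-false (y ≟ c) y≢c | dec-false (y ≟ d) y≢d = refl
  cancel : ∀ {N} (c d y z : Fin N) → PC.transpose c d y ≡ PC.transpose c d z → y ≡ z
  cancel c d y z eq =
    trans (sym (PC.transpose-inverse d c)) (trans (cong (PC.transpose d c) eq) (PC.transpose-inverse d c))
  b' = PC.transpose a p b
  f : _ → _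
  f y = PC.transpose b' q (PC.transpose a p y)
  f-injective : Injective _≡_ _≡_ f
  f-injective {y} {z} eq = cancel a p y z (cancel b' q _ _ eq)
  p≢b' : p ≢ b'
  p≢b' eq = a≢b (trans (sym (sends p a)) (trans (cong (PC.transpose p a) eq) (PC.transpose-inverse p a)))
  fa≡p : f a ≡ p
  fa≡p = trans (cong (PC.transpose b' q) (sends a p)) (fixes b' q p p≢b' p≢q)
  fb≡q : f b ≡ q
  fb≡q = sends b' q

-- The links of H have extremal number 0: a graph with an edge {p, q}
-- contains the link of x, which is a single edge, and the empty graph
-- contains no link since every link has an edge.
links-ex : ∀ t u v → u ≢ v → IsEx 2 (5 * suc t) (link (Hgraph (suc t) u v)) 0
links-ex t u v u≢v = (empty , (λ e ()) , emptyFree , edges-empty (5 * suc t)) , bound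
  where
  H = Hgraph (suc t) u v
  empty : Hyp (5 * suc t)
  empty _ = false
  emptyFree : Free empty (link H)
  emptyFree w (f , _ , hom) with link-nonempty t u v w
  ... | e , we∈H with hom e we∈H
  ...   | ()
  u'≢v' : inV₁ t u ≢ inV₁ t v
  u'≢v' eq = u≢v (FP.toℕ-injective (trans (sym (toℕ-inV₁ t u)) (trans (cong toℕ eq) (toℕ-inV₁ t v))))
  contains-link-x : (G : Hyp (5 * suc t)) → Uniform 2 G → ∀ e → G e ≡ true → Contains G (link H zero)
  contains-link-x G uni e Ge with size2⇒pair e (uni e Ge)
  ... | p , q , p≢q , e≡pq with move-pair (inV₁ t u) (inV₁ t v) p q u'≢v' p≢q
  ...   | f , f-injective , fu≡p , fv≡q = f , f-injective , λ e' xe'∈H → begin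
    G (img f e')                                  ≡⟨ cong (λ e'' → G (img f e'')) (link-x t u v e' xe'∈H) ⟩
    G (img f ⟦ inV₁ t u ∷ inV₁ t v ∷ [] ⟧)        ≡⟨ cong G (img-⟦⟧ f (inV₁ t u ∷ inV₁ t v ∷ [])) ⟩
    G ⟦ f (inV₁ t u) ∷ f (inV₁ t v) ∷ [] ⟧        ≡⟨ cong₂ (λ a b → G ⟦ a ∷ b ∷ [] ⟧) fu≡p fv≡q ⟩
    G ⟦ p ∷ q ∷ [] ⟧                              ≡⟨ cong G (sym e≡pq) ⟩
    G e                                           ≡⟨ Ge ⟩
    true                                          ∎
    where open ≡-Reasoning
  bound : ∀ G → Uniform 2 G → Free G (link H) → edges G ≤ 0
  bound G uni free with edges G in eq
  ... | zero = z≤n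
  ... | suc k with edge-of-positive G k eq
  ...   | e , Ge = ⊥-elim (free zero (contains-link-x G uni e Ge))

-- Three colours, cycled by next.  In a vertex sequence whose first vertex
-- has colour γ, vertex j has colour γ + j (mod 3).
next : Fin 3 → Fin 3
next zero = suc zero
next (suc zero) = suc (suc zero)
next (suc (suc zero)) = zero

next³ : ∀ γ → next (next (next γ)) ≡ γ
next³ zero = refl
next³ (suc zero) = refl
next³ (suc (suc zero)) = refl

colour : ∀ {m} → Fin 3 → Fin m → Fin 3
colour γ zero = γ
colour γ (suc j) = colour (next γ) j

-- avoids δ γ r: no vertex of r, coloured starting from δ, has colour γ.
avoids : ∀ {m} → Fin 3 → Fin 3 → Subset m → Bool
avoids δ γ [] = true
avoids δ γ (b ∷ r) = (not b ∨ not (does (δ ≟ γ))) ∧ avoids (next δ) γ r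

-- firstDiffers γ r: the first vertex of r, coloured starting from γ, has a
-- colour different from all later vertices of r.
firstDiffers : ∀ {m} → Fin 3 → Subset m → Bool
firstDiffers γ [] = false
firstDiffers γ (true ∷ r) = avoids (next γ) γ r
firstDiffers γ (false ∷ r) = firstDiffers (next γ) r

-- The edges of the complete tripartite graph whose colour classes are the
-- residues of the vertices mod 3.
tripartite : ∀ {m} → Subset m → Bool
tripartite r = (∣ r ∣ ≡ᵇ 2) ∧ firstDiffers zero r

avoids⇒colour≢ : ∀ {m} δ γ (d : Fin m) → avoids δ γ ⟦ d ∷ [] ⟧ ≡ true → colour δ d ≢ γ
avoids⇒colour≢ δ γ zero eq = doesNot δ γ (proj₁ (∧-elim eq))
avoids⇒colour≢ δ γ (suc d) eq = avoids⇒colour≢ (next δ) γ d eq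

firstDiffers⇒colour≢ : ∀ {m} γ (c d : Fin m) → c ≢ d → firstDiffers γ ⟦ c ∷ d ∷ [] ⟧ ≡ true →
  colour γ c ≢ colour γ d
firstDiffers⇒colour≢ γ zero zero c≢d eq = ⊥-elim (c≢d refl)
firstDiffers⇒colour≢ γ zero (suc d) c≢d eq = λ same → avoids⇒colour≢ (next γ) γ d eq (sym same)
firstDiffers⇒colour≢ γ (suc c) zero c≢d eq = avoids⇒colour≢ (next γ) γ c eq
firstDiffers⇒colour≢ γ (suc c) (suc d) c≢d eq =
  firstDiffers⇒colour≢ (next γ) c d (λ c≡d → c≢d (cong suc c≡d)) eq

-- Counting tripartite edges.  outside δ γ m is the number of the first m
-- vertices (coloured from δ) not of colour γ; triEdges γ m is the number of
-- edges of the complete tripartite graph on m vertices coloured from γ.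
outside : Fin 3 → Fin 3 → ℕ → ℕ
outside δ γ zero = 0
outside δ γ (suc m) = (if does (δ ≟ γ) then 0 else 1) + outside (next δ) γ m

triEdges : Fin 3 → ℕ → ℕ
triEdges γ zero = 0
triEdges γ (suc m) = outside (next γ) γ m + triEdges (next γ) m

count-avoiding-empty : ∀ m δ γ → edges {m} (λ r → (∣ r ∣ ≡ᵇ 0) ∧ avoids δ γ r) ≡ 1
count-avoiding-empty zero δ γ = refl
count-avoiding-empty (suc m) δ γ = trans (edges-split {m} (λ r → (∣ r ∣ ≡ᵇ 0) ∧ avoids δ γ r))
  (cong₂ _+_ (edges-empty m) (count-avoiding-empty m (next δ) γ))

count-avoiding-singletons : ∀ m δ γ → edges {m} (λ r → (∣ r ∣ ≡ᵇ 1) ∧ avoids δ γ r) ≡ outside δ γ m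
count-avoiding-singletons zero δ γ = refl
count-avoiding-singletons (suc m) δ γ =
  trans (edges-split {m} (λ r → (∣ r ∣ ≡ᵇ 1) ∧ avoids δ γ r))
        (cong₂ _+_ (firstVertex (does (δ ≟ γ))) (count-avoiding-singletons m (next δ) γ))
  where
  firstVertex : ∀ b → edges {m} (λ r → (∣ r ∣ ≡ᵇ 0) ∧ (not b ∧ avoids (next δ) γ r)) ≡ (if b then 0 else 1)
  firstVertex true = trans (edges-cong {m} _ _ (λ r → BP.∧-zeroʳ (∣ r ∣ ≡ᵇ 0))) (edges-empty m)
  firstVertex false = count-avoiding-empty m (next δ) γ

count-tripartite : ∀ m γ → edges {m} (λ r → (∣ r ∣ ≡ᵇ 2) ∧ firstDiffers γ r) ≡ triEdges γ m
count-tripartite zero γ = refl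
count-tripartite (suc m) γ = trans (edges-split {m} (λ r → (∣ r ∣ ≡ᵇ 2) ∧ firstDiffers γ r))
  (cong₂ _+_ (count-avoiding-singletons m (next γ) γ) (count-tripartite m (next γ)))

-- Among the first m vertices coloured from next γ, those not of colour γ
-- are those whose index is not 2 mod 3.
notThird : ℕ → ℕ
notThird zero = 0
notThird (suc zero) = 1
notThird (suc (suc zero)) = 2
notThird (suc (suc (suc m))) = 2 + notThird m

outside-next : ∀ γ m → outside (next γ) γ m ≡ notThird m
outside-next γ zero = refl
outside-next zero (suc zero) = refl
outside-next zero (suc (suc zero)) = refl
outside-next zero (suc (suc (suc m))) = cong (2 +_) (outside-next zero m)
outside-next (suc zero) (suc zero) = refl
outside-next (suc zero) (suc (suc zero)) = refl
outside-next (suc zero) (suc (suc (suc m))) = cong (2 +_) (outside-next (suc zero) m)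
outside-next (suc (suc zero)) (suc zero) = refl
outside-next (suc (suc zero)) (suc (suc zero)) = refl
outside-next (suc (suc zero)) (suc (suc (suc m))) = cong (2 +_) (outside-next (suc (suc zero)) m)

notThird-window : ∀ m → notThird (2 + m) + (notThird (1 + m) + notThird m) ≡ 3 + 2 * m
notThird-window zero = refl
notThird-window (suc zero) = refl
notThird-window (suc (suc zero)) = refl
notThird-window (suc (suc (suc m))) =
  trans (regroup (notThird (2 + m)) (notThird (1 + m)) (notThird m))
        (trans (cong (6 +_) (notThird-window m)) (shift m))
  where
  regroup : ∀ a b c → (2 + a) + ((2 + b) + (2 + c)) ≡ 6 + (a + (b + c))
  regroup = solve-∀
  shift : ∀ m → 6 + (3 + 2 * m) ≡ 3 + 2 * (3 + m)
  shift = solve-∀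

triEdges-step : ∀ γ m → triEdges γ (3 + m) ≡ (3 + 2 * m) + triEdges γ m
triEdges-step γ m
  rewrite outside-next γ (2 + m) | outside-next (next γ) (1 + m)
        | outside-next (next (next γ)) m | next³ γ =
  trans (regroup (notThird (2 + m)) (notThird (1 + m)) (notThird m) (triEdges γ m))
        (cong (_+ triEdges γ m) (notThird-window m))
  where
  regroup : ∀ a b c e → a + (b + (c + e)) ≡ (a + (b + c)) + e
  regroup = solve-∀

triEdges-large : ∀ γ m → m * m ≤ 3 * triEdges γ m + m
triEdges-large γ zero = z≤n
triEdges-large γ (suc zero) = s≤s z≤n
triEdges-large γ (suc (suc zero)) rewrite outside-next γ 1 =
  NP.≤-trans (s≤s (s≤s (s≤s (s≤s z≤n))))
             (NP.+-monoˡ-≤ 2 (NP.*-monoʳ-≤ 3 (NP.m≤m+n 1 (triEdges (next γ) 1))))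
triEdges-large γ (suc (suc (suc m))) rewrite triEdges-step γ m = begin
  (3 + m) * (3 + m)                                ≡⟨ expand m ⟩
  m * m + (6 * m + 9)                              ≤⟨ NP.+-monoˡ-≤ (6 * m + 9) (triEdges-large γ m) ⟩
  (3 * triEdges γ m + m) + (6 * m + 9)             ≤⟨ NP.m≤m+n _ 3 ⟩
  (3 * triEdges γ m + m) + (6 * m + 9) + 3         ≡⟨ collect m (triEdges γ m) ⟩
  3 * ((3 + 2 * m) + triEdges γ m) + (3 + m)       ∎
  where
  open NP.≤-Reasoning
  expand : ∀ m → (3 + m) * (3 + m) ≡ m * m + (6 * m + 9)
  expand = solve-∀
  collect : ∀ m e → ((3 * e + m) + (6 * m + 9)) + 3 ≡ 3 * ((3 + 2 * m) + e) + (3 + m)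
  collect = solve-∀

-- The construction on 2 + m vertices a = 0, b = 1 and m further vertices:
-- all triples of further vertices, and {a,y,z}, {b,y,z} for every
-- tripartite edge yz of the further vertices.
construction : ∀ {m} → Hyp (suc (suc m))
construction (true ∷ true ∷ r) = false
construction (true ∷ false ∷ r) = tripartite r
construction (false ∷ true ∷ r) = tripartite r
construction (false ∷ false ∷ r) = ∣ r ∣ ≡ᵇ 3

edges-construction : ∀ m → edges (construction {m}) ≡ (0 + triEdges zero m) + (triEdges zero m + m C 3)
edges-construction m = trans (edges-split {suc m} construction) (cong₂ _+_ withA withoutA)
  where
  withA : edges {suc m} (λ r → construction (true ∷ r)) ≡ 0 + triEdges zero m
  withA = trans (edges-split {m} (λ r → construction (true ∷ r)))
                (cong₂ _+_ (edges-empty m) (count-tripartite m zero))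
  withoutA : edges {suc m} (λ r → construction (false ∷ r)) ≡ triEdges zero m + m C 3
  withoutA = trans (edges-split {m} (λ r → construction (false ∷ r)))
                   (cong₂ _+_ (count-tripartite m zero) (edges-complete m 3))

construction-uniform : ∀ {m} → Uniform 3 (construction {m})
construction-uniform (true ∷ true ∷ r) ()
construction-uniform (true ∷ false ∷ r) eq = cong suc (≡ᵇ⇒≡ (proj₁ (∧-elim eq)))
construction-uniform (false ∷ true ∷ r) eq = cong suc (≡ᵇ⇒≡ (proj₁ (∧-elim eq)))
construction-uniform (false ∷ false ∷ r) eq = ≡ᵇ⇒≡ eq

vertexColour : ∀ {m} → Fin (suc (suc m)) → Fin 3
vertexColour zero = zero
vertexColour (suc zero) = zero
vertexColour (suc (suc j)) = colour zero j

ColouredLink : ∀ {m} → Fin (suc (suc m)) → Set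
ColouredLink {m} α = ∀ c d → c ≢ α → d ≢ α → c ≢ d →
  construction {m} ⟦ α ∷ c ∷ d ∷ [] ⟧ ≡ true → vertexColour c ≢ vertexColour d

-- This holds for a (the links of a and b are copies of the tripartite graph) ...
link-a-coloured : ∀ {m} → ColouredLink {m} zero
link-a-coloured zero d c≢a d≢a c≢d eq = ⊥-elim (c≢a refl)
link-a-coloured c zero c≢a d≢a c≢d eq = ⊥-elim (d≢a refl)
link-a-coloured (suc zero) (suc d) c≢a d≢a c≢d ()
link-a-coloured (suc (suc c)) (suc zero) c≢a d≢a c≢d ()
link-a-coloured (suc (suc c)) (suc (suc d)) c≢a d≢a c≢d eq =
  firstDiffers⇒colour≢ zero c d (λ c≡d → c≢d (cong (λ y → suc (suc y)) c≡d)) (proj₂ (∧-elim eq))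

link-b-coloured : ∀ {m} → ColouredLink {m} (suc zero)
link-b-coloured (suc zero) d c≢b d≢b c≢d eq = ⊥-elim (c≢b refl)
link-b-coloured c (suc zero) c≢b d≢b c≢d eq = ⊥-elim (d≢b refl)
link-b-coloured zero zero c≢b d≢b c≢d eq = ⊥-elim (c≢d refl)
link-b-coloured zero (suc (suc d)) c≢b d≢b c≢d ()
link-b-coloured (suc (suc c)) zero c≢b d≢b c≢d ()
link-b-coloured (suc (suc c)) (suc (suc d)) c≢b d≢b c≢d eq =
  firstDiffers⇒colour≢ zero c d (λ c≡d → c≢d (cong (λ y → suc (suc y)) c≡d)) (proj₂ (∧-elim eq))

injective⇒surjective : ∀ {n} (f : Fin n → Fin n) → Injective _≡_ _≡_ f → ∀ a → ∃ λ p → f p ≡ a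
injective⇒surjective {suc n} f inj a with FP.any? (λ p → f p ≟ a)
... | yes hit = hit
... | no miss with FP.pigeonhole (NP.n<1+n n) (λ p → punchOut {i = a} {j = f p} (λ eq → miss (p , sym eq)))
...   | i , j , i<j , eq = ⊥-elim (NP.<-irrefl (cong toℕ (inj (FP.punchOut-injective {i = a}
          (λ eq → miss (i , sym eq)) (λ eq → miss (j , sym eq)) eq))) i<j)

-- Under an embedding f of H into the construction, no block vertex goes to
-- a vertex α with properly coloured link: the four other vertices of its
-- block are sent into that link, pairwise adjacent, and by pigeonhole two
-- of them get the same of the three colours.
block-vertex-avoids : ∀ t u v (f : Fin (suc (5 * suc t)) → Fin (suc (5 * suc t))) →
  Injective _≡_ _≡_ f → IsHom (construction {t + 4 * suc t}) (Hgraph (suc t) u v) f →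
  ∀ α → ColouredLink α → ∀ w → w ≢ zero → f w ≢ α
block-vertex-avoids t u v f f-injective f-hom α coloured w w≢x fw≡α
  with block-decomposition {suc t} w w≢x
... | i , r , w≡vtx = sameColour⇒⊥ (FP.pigeonhole (NP.n<1+n 3) colourOf)
  where
  fvtx≡α : f (vtx i r) ≡ α
  fvtx≡α = trans (cong f (sym w≡vtx)) fw≡α
  other : Fin 4 → Fin 5
  other = punchIn r
  colourOf : Fin 4 → Fin 3
  colourOf k = vertexColour (f (vtx i (other k)))
  r≢other : ∀ k → r ≢ other k
  r≢other k eq = FP.punchInᵢ≢i r k (sym eq)
  other≢α : ∀ k → f (vtx i (other k)) ≢ α
  other≢α k eq = r≢other k (sym (vtx-injective i _ _ (f-injective (trans eq (sym fvtx≡α)))))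
  sameColour⇒⊥ : (∃ λ k₁ → ∃ λ k₂ → k₁ <ᶠ k₂ × colourOf k₁ ≡ colourOf k₂) → ⊥
  sameColour⇒⊥ (k₁ , k₂ , k₁<k₂ , same) =
    coloured (f (vtx i (other k₁))) (f (vtx i (other k₂))) (other≢α k₁) (other≢α k₂)
      (λ eq → others≢ (vtx-injective i _ _ (f-injective eq))) inLinkOfα same
    where
    others≢ : other k₁ ≢ other k₂
    others≢ eq = NP.<-irrefl (cong toℕ (FP.punchIn-injective r k₁ k₂ eq)) k₁<k₂
    block : List (Fin (suc (5 * suc t)))
    block = vtx i r ∷ vtx i (other k₁) ∷ vtx i (other k₂) ∷ []
    image-edge : construction ⟦ map f block ⟧ ≡ true
    image-edge = trans (cong construction (sym (img-⟦⟧ f block)))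
      (f-hom ⟦ block ⟧ (block-edge (suc t) u v i r (other k₁) (other k₂) (r≢other k₁) (r≢other k₂) others≢))
    inLinkOfα : construction ⟦ α ∷ f (vtx i (other k₁)) ∷ f (vtx i (other k₂)) ∷ [] ⟧ ≡ true
    inLinkOfα = subst (λ a → construction ⟦ a ∷ f (vtx i (other k₁)) ∷ f (vtx i (other k₂)) ∷ [] ⟧ ≡ true)
                      fvtx≡α image-edge

-- The construction is H-free: an embedding is onto, so a and b have
-- preimages; at most one of them is x, so a block vertex goes to a or b.
construction-H-free : ∀ t u v → ¬ Contains (construction {t + 4 * suc t}) (Hgraph (suc t) u v)
construction-H-free t u v (f , f-injective , f-hom)
  with injective⇒surjective f f-injective zero | injective⇒surjective f f-injective (suc zero)
... | p , fp≡a | q , fq≡b with p ≟ zero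
...   | no p≢x = block-vertex-avoids t u v f f-injective f-hom zero link-a-coloured p p≢x fp≡a
...   | yes refl = block-vertex-avoids t u v f f-injective f-hom (suc zero) link-b-coloured q q≢x fq≡b
  where
  q≢x : q ≢ zero
  q≢x refl with trans (sym fq≡b) fp≡a
  ... | ()

double-choose2 : ∀ m → 2 * (m C 2) + m ≡ m * m
double-choose2 zero = refl
double-choose2 (suc m) = begin
  2 * (suc m C 2) + suc m              ≡⟨ cong (λ c → 2 * c + suc m) (sym (nCk+nC[k+1]≡[n+1]C[k+1] m 1)) ⟩
  2 * (m C 1 + m C 2) + suc m          ≡⟨ cong (λ c → 2 * (c + m C 2) + suc m) (nC1≡n m) ⟩
  2 * (m + m C 2) + suc m              ≡⟨ regroup m (m C 2) ⟩
  (2 * (m C 2) + m) + (2 * m + 1)      ≡⟨ cong (_+ (2 * m + 1)) (double-choose2 m) ⟩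
  m * m + (2 * m + 1)                  ≡⟨ square m ⟩
  suc m * suc m                        ∎
  where
  open ≡-Reasoning
  regroup : ∀ m c → 2 * (m + c) + suc m ≡ (2 * c + m) + (2 * m + 1)
  regroup = solve-∀
  square : ∀ m → m * m + (2 * m + 1) ≡ suc m * suc m
  square = solve-∀

triEdges-vs-choose2 : ∀ γ m → 2 * (m C 2) ≤ 3 * triEdges γ m
triEdges-vs-choose2 γ m = NP.+-cancelʳ-≤ m (2 * (m C 2)) (3 * triEdges γ m)
  (subst (_≤ 3 * triEdges γ m + m) (sym (double-choose2 m)) (triEdges-large γ m))

-- With a = C(m,3), b = C(m,2), c = e(T): if 2b ≤ 3c and the construction
-- (of size c + c + a) has at most N edges, then 3a + 4b ≤ 3N.
lower-bound-arith : ∀ a b c N → 2 * b ≤ 3 * c → (0 + c) + (c + a) ≤ N → 3 * a + 4 * b ≤ 3 * N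
lower-bound-arith a b c N 2b≤3c size≤N = begin
  3 * a + 4 * b                  ≡⟨ double a b ⟩
  3 * a + 2 * (2 * b)            ≤⟨ NP.+-monoʳ-≤ (3 * a) (NP.*-monoʳ-≤ 2 2b≤3c) ⟩
  3 * a + 2 * (3 * c)            ≡⟨ collect a c ⟩
  3 * ((0 + c) + (c + a))        ≤⟨ NP.*-monoʳ-≤ 3 size≤N ⟩
  3 * N                          ∎
  where
  open NP.≤-Reasoning
  double : ∀ a b → 3 * a + 4 * b ≡ 3 * a + 2 * (2 * b)
  double = solve-∀
  collect : ∀ a c → 3 * a + 2 * (3 * c) ≡ 3 * ((0 + c) + (c + a))
  collect = solve-∀

pascal-arith : ∀ a b c → b + a ≡ c → 3 * a + 4 * b ≡ 3 * c + b
pascal-arith a b c b+a≡c = trans (regroup a b) (cong (λ x → 3 * x + b) b+a≡c)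
  where
  regroup : ∀ a b → 3 * a + 4 * b ≡ 3 * (b + a) + b
  regroup = solve-∀

choose2-positive : ∀ m → 2 ≤ m → 1 ≤ m C 2
choose2-positive (suc zero) (s≤s ())
choose2-positive (suc (suc k)) _ = subst (1 ≤_) (nCk+nC[k+1]≡[n+1]C[k+1] (suc k) 1)
  (NP.≤-trans (subst (1 ≤_) (sym (nC1≡n (suc k))) (s≤s z≤n)) (NP.m≤m+n _ _))

Conclusion : ℕ → Fin 5 → Fin 5 → ℕ → ℕ → Set
Conclusion s u v L N =
  IsEx 2 (5 * s) (link (Hgraph s u v)) L
  × L ≡ 0
  × IsEx 3 (suc (5 * s)) (λ (_ : ⊤) → Hgraph s u v) N
  × 3 * ((suc (5 * s) ∸ 2) C 3) + 4 * ((suc (5 * s) ∸ 2) C 2) ≤ 3 * N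
  × 3 * ((suc (5 * s) ∸ 2) C 3) + 4 * ((suc (5 * s) ∸ 2) C 2)
      ≡ 3 * ((suc (5 * s) ∸ 1) C 3) + ((suc (5 * s) ∸ 2) C 2)
  × 3 * ((suc (5 * s) ∸ 1) C 3) + 3 * L < 3 * ((suc (5 * s) ∸ 1) C 3) + ((suc (5 * s) ∸ 2) C 2)

-- The proposition for s = t + 1, where n - 2 = m = t + 4(t + 1).
proposition-for : ∀ t u v → u ≢ v → ∃[ L ] ∃[ N ] Conclusion (suc t) u v L N
proposition-for t u v u≢v = 0 , N , links-ex t u v u≢v , refl , exN , lower-bound , pascal , strict
  where
  m : ℕ
  m = t + 4 * suc t
  exH : ∃ λ N → IsEx 3 (suc (5 * suc t)) (λ (_ : ⊤) → Hgraph (suc t) u v) N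
  exH = ex-exists 3 (suc (5 * suc t)) (Hgraph (suc t) u v)
    (⟦ zero ∷ suc (inV₁ t u) ∷ suc (inV₁ t v) ∷ [] ⟧ , special-edge t u v)
  N : ℕ
  N = proj₁ exH
  exN : IsEx 3 (suc (5 * suc t)) (λ (_ : ⊤) → Hgraph (suc t) u v) N
  exN = proj₂ exH
  construction≤N : edges (construction {m}) ≤ N
  construction≤N = proj₂ exN construction construction-uniform (λ _ → construction-H-free t u v)
  lower-bound : 3 * (m C 3) + 4 * (m C 2) ≤ 3 * N
  lower-bound = lower-bound-arith (m C 3) (m C 2) (triEdges zero m) N (triEdges-vs-choose2 zero m)
    (subst (_≤ N) (edges-construction m) construction≤N)
  pascal : 3 * (m C 3) + 4 * (m C 2) ≡ 3 * (suc m C 3) + m C 2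
  pascal = pascal-arith (m C 3) (m C 2) (suc m C 3) (nCk+nC[k+1]≡[n+1]C[k+1] m 2)
  strict : 3 * (suc m C 3) + 3 * 0 < 3 * (suc m C 3) + m C 2
  strict = NP.+-monoʳ-< (3 * (suc m C 3)) (choose2-positive m 2≤m)
    where
    2≤m : 2 ≤ m
    2≤m = NP.≤-trans (s≤s (s≤s z≤n)) (NP.≤-trans (NP.*-monoʳ-≤ 4 (s≤s (z≤n {t}))) (NP.m≤n+m (4 * suc t) t))

proposition1p2 : ∃[ s₀ ] ∀ (s : ℕ) → s₀ ≤ s → (u v : Fin 5) → u ≢ v →
    ∃[ L ] ∃[ N ]
      IsEx 2 (5 * s) (link (Hgraph s u v)) L
      × L ≡ 0
      × IsEx 3 (suc (5 * s)) (λ (_ : ⊤) → Hgraph s u v) N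
      × 3 * ((suc (5 * s) ∸ 2) C 3) + 4 * ((suc (5 * s) ∸ 2) C 2) ≤ 3 * N
      × 3 * ((suc (5 * s) ∸ 2) C 3) + 4 * ((suc (5 * s) ∸ 2) C 2)
          ≡ 3 * ((suc (5 * s) ∸ 1) C 3) + ((suc (5 * s) ∸ 2) C 2)
      × 3 * ((suc (5 * s) ∸ 1) C 3) + 3 * L < 3 * ((suc (5 * s) ∸ 1) C 3) + ((suc (5 * s) ∸ 2) C 2)
proposition1p2 = 1 , λ where
  zero ()
  (suc t) _ u v u≢v → proposition-for t u v u≢v
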